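{- Let $M=(E,r)$ be a $q$-matroid and $\mathcal{Z}$ its set of cyclic flats. Then $\mathcal{Z}$, ordered by inclusion, is a lattice in which the meet of $F_1,F_2\in\mathcal{Z}$ is $\mathrm{cyc}(F_1\cap F_2)$ and the join is $\mathrm{cl}(F_1+F_2)$.
   Context: Let $q$ be a prime power and $E$ an $n$-dimensional $\mathbb{F}_q$-vector space. A $q$-matroid $(E,r)$ is a function $r$ from subspaces of $E$ to $\mathbb{Z}$ with (R1) $0\le r(A)\le\dim A$, (R2) $r(A)\le r(B)$ if $A\le B$, (R3) $r(A+B)+r(A\cap B)\le r(A)+r(B)$. $\mathrm{cl}(A)=\sum x$ over all $1$-dimensional $x\le E$ with $r(A+x)=r(A)$. $\mathrm{cyc}(A)=\sum x$ over all $1$-dimensional $x\le A$ with $r(B+x)=r(B)$ for every subspace $B\le A$ of codimension $1$ in $A$. A flat is a subspace $F$ with $r(F+x)>r(F)$ for all $1$-dimensional $x\not\le F$; a subspace $A$ is cyclic if $r(B)=r(A)$ for every $B\le A$ of codimension $1$ in $A$; a cyclic flat is a subspace that is both. -}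

module Defs where

open import Level using (0ℓ)
open import Data.Nat as ℕ using (ℕ; zero; suc)
open import Data.Nat.Primality using (Prime)
open import Data.Fin as Fin using (Fin)
open import Data.Bool using (Bool; true; false; _∧_)
open import Data.List as List using (List; []; _∷_; allFin; concatMap)
open import Data.Bool.ListAction using (any)
open import Data.Vec as Vec using (Vec; []; _∷_; zipWith; replicate)
open import Data.Vec.Properties using (≡-dec)
open import Data.Vec.Relation.Unary.All as VAll using ()
open import Data.Integer as ℤ using (ℤ; +_)
open import Data.Product using (Σ; Σ-syntax; ∃; ∃-syntax; _×_; _,_)
open import Relation.Nullary using (¬_; does)
open import Relation.Binary.PropositionalEquality using (_≡_; _≢_)
open import Algebra.Structures using (IsCommutativeRing)

IsPrimePower : ℕ → Set
IsPrimePower q = Σ[ p ∈ ℕ ] Σ[ k ∈ ℕ ] (Prime p × q ≡ p ℕ.^ suc k)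

-- A finite field with q elements, presented on the carrier Fin q
-- (every field of order q is isomorphic to one of these).

record FiniteField (q : ℕ) : Set where
  field
    _+_ _*_ : Fin q → Fin q → Fin q
    -_      : Fin q → Fin q
    0# 1#   : Fin q
    isCommutativeRing : IsCommutativeRing _≡_ _+_ _*_ -_ 0# 1#
    0≢1     : 0# ≢ 1#
    inverse : ∀ x → x ≢ 0# → ∃[ y ] (x * y ≡ 1#)

module Setting {q : ℕ} (𝔽 : FiniteField q) (n : ℕ) where
  open FiniteField 𝔽

  V : Set
  V = Vec (Fin q) n

  _⊕_ : V → V → V
  _⊕_ = zipWith _+_

  _·_ : Fin q → V → V
  c · v = Vec.map (c *_) v

  𝟎 : V
  𝟎 = replicate n 0#

  _≟V_ : (u v : V) → Relation.Nullary.Dec (u ≡ v)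
  _≟V_ = ≡-dec Fin._≟_

  allVecs : (m : ℕ) → List (Vec (Fin q) m)
  allVecs zero    = [] ∷ []
  allVecs (suc m) = concatMap (λ x → List.map (x ∷_) (allVecs m)) (allFin q)

  Sub : Set
  Sub = V → Bool

  _∈_ : V → Sub → Set
  v ∈ A = A v ≡ true

  _≤_ : Sub → Sub → Set
  A ≤ B = ∀ v → v ∈ A → v ∈ B

  IsSubspace : Sub → Set
  IsSubspace A = (𝟎 ∈ A)
               × (∀ u v → u ∈ A → v ∈ A → (u ⊕ v) ∈ A)
               × (∀ c v → v ∈ A → (c · v) ∈ A)

  _∩_ : Sub → Sub → Sub
  (A ∩ B) v = A v ∧ B v

  _+S_ : Sub → Sub → Sub
  (A +S B) v = any (λ a → any (λ b → A a ∧ (B b ∧ does ((a ⊕ b) ≟V v)))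
                              (allVecs n))
                   (allVecs n)

  lincomb : ∀ {k} → Vec (Fin q) k → Vec V k → V
  lincomb []       []       = 𝟎
  lincomb (c ∷ cs) (b ∷ bs) = (c · b) ⊕ lincomb cs bs

  LinIndep : ∀ {k} → Vec V k → Set
  LinIndep {k} bs = ∀ cs → lincomb cs bs ≡ 𝟎 → cs ≡ replicate k 0#

  HasDim : Sub → ℕ → Set
  HasDim A k = Σ[ bs ∈ Vec V k ]
                 ( VAll.All (_∈ A) bs
                 × LinIndep bs
                 × (∀ v → v ∈ A → ∃[ cs ] (lincomb cs bs ≡ v)) )

  Codim1 : Sub → Sub → Set
  Codim1 B A = B ≤ A × ∃[ k ] (HasDim A (suc k) × HasDim B k)

  IsPoint : Sub → Set
  IsPoint x = IsSubspace x × HasDim x 1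

  -- q-matroid axioms for r (only values on subspaces matter)
  record IsQMatroid (r : Sub → ℤ) : Set where
    field
      R1-nonneg : ∀ A → IsSubspace A → + 0 ℤ.≤ r A
      R1-dim    : ∀ A k → IsSubspace A → HasDim A k → r A ℤ.≤ + k
      R2        : ∀ A B → IsSubspace A → IsSubspace B → A ≤ B → r A ℤ.≤ r B
      R3        : ∀ A B → IsSubspace A → IsSubspace B →
                  r (A +S B) ℤ.+ r (A ∩ B) ℤ.≤ r A ℤ.+ r B

  module _ (r : Sub → ℤ) where

    -- "C = Σ x over all 1-dim x satisfying P": C is the smallest subspace
    -- containing every 1-dimensional subspace x with P x.
    IsSumOfPoints : (Sub → Set) → Sub → Set
    IsSumOfPoints P C =
        IsSubspace C
      × (∀ x → IsPoint x → P x → x ≤ C)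
      × (∀ D → IsSubspace D → (∀ x → IsPoint x → P x → x ≤ D) → C ≤ D)

    IsCl : Sub → Sub → Set
    IsCl A C = IsSumOfPoints (λ x → r (A +S x) ≡ r A) C

    IsCyc : Sub → Sub → Set
    IsCyc A C = IsSumOfPoints
      (λ x → x ≤ A × (∀ B → IsSubspace B → Codim1 B A → r (B +S x) ≡ r B)) C

    IsFlat : Sub → Set
    IsFlat F = IsSubspace F
             × (∀ x → IsPoint x → ¬ (x ≤ F) → r F ℤ.< r (F +S x))

    IsCyclic : Sub → Set
    IsCyclic A = IsSubspace A
               × (∀ B → IsSubspace B → Codim1 B A → r B ≡ r A)

    IsCyclicFlat : Sub → Set
    IsCyclicFlat F = IsFlat F × IsCyclic F

    IsMeetZ : Sub → Sub → Sub → Set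
    IsMeetZ F₁ F₂ M = IsCyclicFlat M × M ≤ F₁ × M ≤ F₂
      × (∀ G → IsCyclicFlat G → G ≤ F₁ → G ≤ F₂ → G ≤ M)

    IsJoinZ : Sub → Sub → Sub → Set
    IsJoinZ F₁ F₂ J = IsCyclicFlat J × F₁ ≤ J × F₂ ≤ J
      × (∀ G → IsCyclicFlat G → F₁ ≤ G → F₂ ≤ G → J ≤ G)

module Submission where

open import Defs
open import Data.Nat using (ℕ)
open import Data.Integer using (ℤ)
open import Data.Product using (Σ-syntax; _×_)

open import Algebra.Bundles using (CommutativeRing; CommutativeMonoid)
open import Algebra.Structures using (IsCommutativeMonoid)
import Algebra.Properties.CommutativeSemigroup as CommSemigroupProperties
import Algebra.Properties.Ring as RingProperties
open import Data.Bool as Bool using (Bool; true; false; _∧_; not)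
open import Data.Bool.ListAction using (any)
open import Data.Bool.Properties using (T-≡; ∧-conicalˡ; ∧-conicalʳ)
open import Data.Empty using (⊥; ⊥-elim)
open import Data.Fin as Fin using (Fin)
open import Data.Integer as ℤ using (0ℤ; 1ℤ)
open import Data.Integer.Properties as ℤ using ()
open import Data.List as List using (List; []; _∷_; _++_; length; filter; cartesianProductWith; allFin)
open import Data.List.Membership.DecPropositional using (_∈?_)
open import Data.List.Membership.Propositional using (find) renaming (_∈_ to _∈ₗ_)
open import Data.List.Membership.Propositional.Properties
  using (∈-allFin; ∈-cartesianProductWith⁺; ∈-map⁺; ∈-map⁻; ∈-filter⁺; ∈-filter⁻; ∈-++⁺ˡ; ∈-++⁺ʳ)
open import Data.List.Membership.Propositional.Properties.WithK using (unique∧set⇒bag)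
open import Data.List.Properties using (length-++; length-map; length-tabulate)
open import Data.List.Relation.Binary.BagAndSetEquality using (∼bag⇒↭)
open import Data.List.Relation.Binary.Permutation.Propositional.Properties using (↭-length)
import Data.List.Relation.Unary.All as All
import Data.List.Relation.Unary.AllPairs as AllPairs
open import Data.List.Relation.Unary.Any as Any using (here; there)
open import Data.List.Relation.Unary.Any.Properties using (any⁺; any⁻)
open import Data.List.Relation.Unary.Unique.Propositional using (Unique)
open import Data.List.Relation.Unary.Unique.Propositional.Properties
  using (cartesianProductWith⁺; allFin⁺; map⁺; filter⁺)
open import Data.Nat as ℕ using (zero; suc; z≤n; s≤s)
open import Data.Nat.Induction using (<-wellFounded)
open import Data.Nat.Properties as ℕ using (m≤n⇒m≤1+n)
open import Data.Product using (∃; ∃-syntax; ∃₂; _,_; proj₁; proj₂)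
open import Data.Sum using (_⊎_; inj₁; inj₂; [_,_]′)
open import Data.Vec as Vec using (Vec; []; _∷_)
open import Data.Vec.Properties
  using (zipWith-assoc; zipWith-comm; zipWith-identityˡ; zipWith-identityʳ;
         map-∘; map-cong; map-id; map-replicate; ∷-injectiveˡ; ∷-injectiveʳ)
open import Data.Vec.Relation.Unary.All as VAll using ([]; _∷_)
open import Function.Bundles using (Equivalence; mk⇔)
open import Induction.WellFounded using (Acc; acc)
open import Level using (0ℓ)
open import Relation.Nullary using (Dec; yes; no; does; ¬_; contradiction)
open import Relation.Nullary.Decidable using (_×-dec_; _→-dec_; dec-true)
open import Relation.Unary using (Pred; Decidable; _⊆_)
open import Relation.Binary.PropositionalEquality

-- The meet. cyc(A) is realised as the intersection of the hyperplanes B of A with r B < r A.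
-- A rank-dropping hyperplane B of A cuts every subspace X ≤ A with X ⊈ B down to a subspace of
-- smaller rank, so cyc(A) is a flat when A is. A hyperplane K of W that misses part of a cyclic
-- Z ≤ W has full rank (W = K + Z and r (K ∩ Z) = r Z), so cyc(A) contains every cyclic subspace
-- of A. It is itself cyclic: intersecting A with rank-dropping hyperplanes down to cyc(A), every
-- rank-dropping hyperplane of the current space lies in one of A that misses the current space,
-- which is impossible once that space is cyc(A).
-- The join. cl(S) = {v | r (S + ⟨v⟩) = r S} has the rank of S by submodularity, hence is the
-- least flat containing S; by the full-rank property again, F₁ + F₂ is cyclic and so is its
-- closure.
-- Hyperplanes given by an apex vector are matched with Codim1 by counting: a subspace with a
-- basis of k vectors has q ^ k elements.

∧-true : ∀ {x y} → x ≡ true → y ≡ true → x ∧ y ≡ true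
∧-true refl refl = refl

dec-true⁻ : ∀ {P : Set} (P? : Dec P) → does P? ≡ true → P
dec-true⁻ (yes p) _ = p

module _ {A : Set} where

  any-∈⁺ : (p : A → Bool) {x : A} {xs : List A} → x ∈ₗ xs → p x ≡ true → any p xs ≡ true
  any-∈⁺ p x∈xs px = Equivalence.to T-≡
    (any⁺ p (Any.map (λ { refl → Equivalence.from T-≡ px }) x∈xs))

  any-∈⁻ : (p : A → Bool) (xs : List A) → any p xs ≡ true → ∃[ x ] (x ∈ₗ xs × p x ≡ true)
  any-∈⁻ p xs h with find (any⁻ p xs (Equivalence.from T-≡ h))
  ... | x , x∈xs , px = x , x∈xs , Equivalence.to T-≡ px

  module _ {xs : List A} (complete : ∀ x → x ∈ₗ xs) {P : Pred A 0ℓ} (P? : Decidable P) where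

    all?-complete : Dec (∀ x → P x)
    all?-complete with All.all? P? xs
    ... | yes all = yes (λ x → All.lookup all (complete x))
    ... | no ¬all = no (λ all → ¬all (All.tabulate (λ {x} _ → all x)))

    any?-complete : Dec (∃ P)
    any?-complete with Any.any? P? xs
    ... | yes some = yes (Any.satisfied some)
    ... | no ¬some = no (λ (x , px) → ¬some (Any.map (λ { refl → px }) (complete x)))

  sublists : List A → List (List A)
  sublists []       = [] ∷ []
  sublists (x ∷ xs) = List.map (x ∷_) (sublists xs) ++ sublists xs

  filter-∈-sublists : {P : Pred A 0ℓ} (P? : Decidable P) (xs : List A) → filter P? xs ∈ₗ sublists xs
  filter-∈-sublists P? []       = here refl
  filter-∈-sublists P? (x ∷ xs) with P? x
  ... | yes _ = ∈-++⁺ˡ (∈-map⁺ (x ∷_) (filter-∈-sublists P? xs))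
  ... | no  _ = ∈-++⁺ʳ (List.map (x ∷_) (sublists xs)) (filter-∈-sublists P? xs)

  module _ {P Q : Pred A 0ℓ} (P? : Decidable P) (Q? : Decidable Q) (P⊆Q : P ⊆ Q) where

    length-filter-mono : ∀ xs → length (filter P? xs) ℕ.≤ length (filter Q? xs)
    length-filter-mono []       = z≤n
    length-filter-mono (x ∷ xs) with P? x | Q? x
    ... | yes _  | yes _  = s≤s (length-filter-mono xs)
    ... | yes px | no ¬qx = contradiction (P⊆Q px) ¬qx
    ... | no _   | yes _  = m≤n⇒m≤1+n (length-filter-mono xs)
    ... | no _   | no _   = length-filter-mono xs

    length-filter-mono-< : ∀ {y} xs → y ∈ₗ xs → Q y → ¬ P y →
                           length (filter P? xs) ℕ.< length (filter Q? xs)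
    length-filter-mono-< (x ∷ xs) (here refl) qx ¬px with P? x | Q? x
    ... | yes px | _      = contradiction px ¬px
    ... | no _   | yes _  = s≤s (length-filter-mono xs)
    ... | no _   | no ¬qx = contradiction qx ¬qx
    length-filter-mono-< (x ∷ xs) (there y∈xs) qy ¬py with P? x | Q? x
    ... | yes _  | yes _  = s≤s (length-filter-mono-< xs y∈xs qy ¬py)
    ... | yes px | no ¬qx = contradiction (P⊆Q px) ¬qx
    ... | no _   | yes _  = m≤n⇒m≤1+n (length-filter-mono-< xs y∈xs qy ¬py)
    ... | no _   | no _   = length-filter-mono-< xs y∈xs qy ¬py

module VectorAlgebra {q : ℕ} (𝔽 : FiniteField q) where
  open FiniteField 𝔽

  𝔽-commutativeRing : CommutativeRing _ _
  𝔽-commutativeRing = record { isCommutativeRing = isCommutativeRing }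

  open CommutativeRing 𝔽-commutativeRing
    using (+-assoc; +-comm; +-identityˡ; +-identityʳ; -‿inverseʳ;
           *-assoc; *-comm; *-identityˡ; distribˡ; distribʳ; zeroˡ; zeroʳ; ring)
  open RingProperties ring using (-1*x≈-x)

  infixl 6 _⊞_ _⊟_
  infixr 7 _⊡_

  -- at length n these are Setting's _⊕_, _·_ and 𝟎
  _⊞_ : ∀ {m} → Vec (Fin q) m → Vec (Fin q) m → Vec (Fin q) m
  _⊞_ = Vec.zipWith _+_

  _⊡_ : ∀ {m} → Fin q → Vec (Fin q) m → Vec (Fin q) m
  c ⊡ v = Vec.map (c *_) v

  𝟘 : ∀ {m} → Vec (Fin q) m
  𝟘 {m} = Vec.replicate m 0#

  _⊟_ : ∀ {m} → Vec (Fin q) m → Vec (Fin q) m → Vec (Fin q) m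
  u ⊟ w = u ⊞ (- 1#) ⊡ w

  module _ {m : ℕ} where

    ⊞-isCommutativeMonoid : IsCommutativeMonoid _≡_ (_⊞_ {m}) 𝟘
    ⊞-isCommutativeMonoid = record
      { isMonoid = record
        { isSemigroup = record
          { isMagma = record { isEquivalence = isEquivalence ; ∙-cong = cong₂ _⊞_ }
          ; assoc = zipWith-assoc +-assoc }
        ; identity = zipWith-identityˡ +-identityˡ , zipWith-identityʳ +-identityʳ }
      ; comm = zipWith-comm +-comm }

    ⊞-commutativeMonoid : CommutativeMonoid _ _
    ⊞-commutativeMonoid = record { isCommutativeMonoid = ⊞-isCommutativeMonoid }

    open IsCommutativeMonoid ⊞-isCommutativeMonoid public
      using () renaming (assoc to ⊞-assoc; comm to ⊞-comm;
                         identityˡ to ⊞-identityˡ; identityʳ to ⊞-identityʳ)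
    open CommSemigroupProperties (CommutativeMonoid.commutativeSemigroup ⊞-commutativeMonoid) public
      using () renaming (interchange to ⊞-interchange)

  ⊡-distribˡ : ∀ {m} c (u v : Vec (Fin q) m) → c ⊡ (u ⊞ v) ≡ c ⊡ u ⊞ c ⊡ v
  ⊡-distribˡ c []      []      = refl
  ⊡-distribˡ c (a ∷ u) (b ∷ v) = cong₂ _∷_ (distribˡ c a b) (⊡-distribˡ c u v)

  ⊡-distribʳ : ∀ {m} c d (v : Vec (Fin q) m) → (c + d) ⊡ v ≡ c ⊡ v ⊞ d ⊡ v
  ⊡-distribʳ c d []      = refl
  ⊡-distribʳ c d (a ∷ v) = cong₂ _∷_ (distribʳ a c d) (⊡-distribʳ c d v)

  ⊡-assoc : ∀ {m} c d (v : Vec (Fin q) m) → (c * d) ⊡ v ≡ c ⊡ d ⊡ v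
  ⊡-assoc c d v = trans (map-cong (*-assoc c d) v) (map-∘ (c *_) (d *_) v)

  ⊡-identityˡ : ∀ {m} (v : Vec (Fin q) m) → 1# ⊡ v ≡ v
  ⊡-identityˡ v = trans (map-cong *-identityˡ v) (map-id v)

  ⊡-zeroˡ : ∀ {m} (v : Vec (Fin q) m) → 0# ⊡ v ≡ 𝟘
  ⊡-zeroˡ []      = refl
  ⊡-zeroˡ (a ∷ v) = cong₂ _∷_ (zeroˡ a) (⊡-zeroˡ v)

  ⊡-zeroʳ : ∀ {m} c → c ⊡ 𝟘 {m} ≡ 𝟘
  ⊡-zeroʳ {m} c = trans (map-replicate (c *_) 0# m) (cong (Vec.replicate m) (zeroʳ c))

  ⊟-self : ∀ {m} (v : Vec (Fin q) m) → v ⊟ v ≡ 𝟘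
  ⊟-self []      = refl
  ⊟-self (a ∷ v) = cong₂ _∷_ (trans (cong (a +_) (-1*x≈-x a)) (-‿inverseʳ a)) (⊟-self v)

  ⊞⇒⊟ : ∀ {m} {u v w : Vec (Fin q) m} → u ⊞ w ≡ v → u ≡ v ⊟ w
  ⊞⇒⊟ {u = u} {v} {w} u⊞w≡v = begin
    u                      ≡⟨ ⊞-identityʳ u ⟨
    u ⊞ 𝟘                  ≡⟨ cong (u ⊞_) (⊟-self w) ⟨
    u ⊞ (w ⊟ w)            ≡⟨ ⊞-assoc u w _ ⟨
    (u ⊞ w) ⊞ (- 1#) ⊡ w   ≡⟨ cong (_⊞ (- 1#) ⊡ w) u⊞w≡v ⟩
    v ⊟ w                  ∎
    where open ≡-Reasoning

  ⊞-cancelʳ : ∀ {m} (u v w : Vec (Fin q) m) → u ⊞ w ≡ v ⊞ w → u ≡ v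
  ⊞-cancelʳ u v w eq = trans (⊞⇒⊟ eq) (sym (⊞⇒⊟ refl))

  leftInverse : ∀ {c} → c ≢ 0# → ∃[ d ] (d * c ≡ 1#)
  leftInverse {c} c≢0 with d , cd≡1 ← inverse c c≢0 = d , trans (*-comm d c) cd≡1

  ⊡-inverse : ∀ {m} {c d} (v : Vec (Fin q) m) → d * c ≡ 1# → d ⊡ c ⊡ v ≡ v
  ⊡-inverse {c = c} {d} v dc≡1 = begin
    d ⊡ c ⊡ v  ≡⟨ ⊡-assoc d c v ⟨
    (d * c) ⊡ v ≡⟨ cong (_⊡ v) dc≡1 ⟩
    1# ⊡ v      ≡⟨ ⊡-identityˡ v ⟩
    v           ∎
    where open ≡-Reasoning

  ⊡-cancel : ∀ {m} {c} {v : Vec (Fin q) m} → c ≢ 0# → c ⊡ v ≡ 𝟘 → v ≡ 𝟘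
  ⊡-cancel {c = c} {v} c≢0 c⊡v≡𝟘 with d , dc≡1 ← leftInverse c≢0 = begin
    v           ≡⟨ ⊡-inverse v dc≡1 ⟨
    d ⊡ c ⊡ v   ≡⟨ cong (d ⊡_) c⊡v≡𝟘 ⟩
    d ⊡ 𝟘       ≡⟨ ⊡-zeroʳ d ⟩
    𝟘           ∎
    where open ≡-Reasoning

module Subspaces {q : ℕ} (𝔽 : FiniteField q) (n : ℕ) where
  open FiniteField 𝔽
  open Setting 𝔽 n
  open VectorAlgebra 𝔽

  allVecs≡cartesianProduct : ∀ m → allVecs (suc m) ≡ cartesianProductWith Vec._∷_ (allFin q) (allVecs m)
  allVecs≡cartesianProduct m = concatMap-map (allFin q)
    where
    concatMap-map : ∀ xs → List.concatMap (λ x → List.map (x Vec.∷_) (allVecs m)) xs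
                           ≡ cartesianProductWith Vec._∷_ xs (allVecs m)
    concatMap-map []       = refl
    concatMap-map (x ∷ xs) = cong (List.map (x Vec.∷_) (allVecs m) ++_) (concatMap-map xs)

  ∈-allVecs : ∀ {m} (v : Vec (Fin q) m) → v ∈ₗ allVecs m
  ∈-allVecs []      = Any.here refl
  ∈-allVecs {suc m} (x ∷ v) rewrite allVecs≡cartesianProduct m =
    ∈-cartesianProductWith⁺ Vec._∷_ (∈-allFin x) (∈-allVecs v)

  allVecs-unique : ∀ m → Unique (allVecs m)
  allVecs-unique zero    = All.[] AllPairs.∷ AllPairs.[]
  allVecs-unique (suc m) rewrite allVecs≡cartesianProduct m =
    cartesianProductWith⁺ Vec._∷_ (λ eq → ∷-injectiveˡ eq , ∷-injectiveʳ eq) (allFin⁺ q) (allVecs-unique m)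

  length-allVecs : ∀ m → length (allVecs m) ≡ q ℕ.^ m
  length-allVecs zero    = refl
  length-allVecs (suc m) rewrite allVecs≡cartesianProduct m =
    trans (length-cartesianProduct (allFin q))
          (cong₂ ℕ._*_ (length-tabulate {n = q} (λ i → i)) (length-allVecs m))
    where
    length-cartesianProduct : ∀ xs → length (cartesianProductWith Vec._∷_ xs (allVecs m))
                                     ≡ length xs ℕ.* length (allVecs m)
    length-cartesianProduct []       = refl
    length-cartesianProduct (x ∷ xs) = trans (length-++ (List.map (x Vec.∷_) (allVecs m)))
      (cong₂ ℕ._+_ (length-map (x Vec.∷_) (allVecs m)) (length-cartesianProduct xs))

  infix 4 _∉_
  _∉_ : V → Sub → Set
  v ∉ A = A v ≡ false

  ∈-or-∉ : ∀ A v → v ∈ A ⊎ v ∉ A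
  ∈-or-∉ A v with A v
  ... | true  = inj₁ refl
  ... | false = inj₂ refl

  ∈∧∉⇒⊥ : ∀ {A v} → v ∈ A → v ∉ A → ⊥
  ∈∧∉⇒⊥ v∈A v∉A with () ← trans (sym v∈A) v∉A

  ≤-refl : ∀ {A} → A ≤ A
  ≤-refl v v∈A = v∈A

  ≤-trans : ∀ {A B C} → A ≤ B → B ≤ C → A ≤ C
  ≤-trans A≤B B≤C v v∈A = B≤C v (A≤B v v∈A)

  ≤-or-escape : ∀ A B → A ≤ B ⊎ ∃[ v ] (v ∈ A × v ∉ B)
  ≤-or-escape A B with any?-complete ∈-allVecs (λ v → (A v Bool.≟ true) ×-dec (B v Bool.≟ false))
  ... | yes escape = inj₂ escape
  ... | no ¬escape = inj₁ λ v v∈A → [ (λ v∈B → v∈B) , (λ v∉B → ⊥-elim (¬escape (v , v∈A , v∉B))) ]′ (∈-or-∉ B v)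

  ∈-∩⁺ : ∀ A B {v} → v ∈ A → v ∈ B → v ∈ (A ∩ B)
  ∈-∩⁺ A B = ∧-true

  ∩-≤ˡ : ∀ A B → (A ∩ B) ≤ A
  ∩-≤ˡ A B v = ∧-conicalˡ (A v) (B v)

  ∩-≤ʳ : ∀ A B → (A ∩ B) ≤ B
  ∩-≤ʳ A B v = ∧-conicalʳ (A v) (B v)

  ∩-glb : ∀ {A B C} → C ≤ A → C ≤ B → C ≤ (A ∩ B)
  ∩-glb C≤A C≤B v v∈C = ∧-true (C≤A v v∈C) (C≤B v v∈C)

  ∈-+S⁺ : ∀ A B {a b v} → a ∈ A → b ∈ B → a ⊕ b ≡ v → v ∈ (A +S B)
  ∈-+S⁺ A B {a} {b} {v} a∈A b∈B a⊕b≡v = any-∈⁺ _ (∈-allVecs a)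
    (any-∈⁺ _ (∈-allVecs b) (∧-true a∈A (∧-true b∈B (dec-true ((a ⊕ b) ≟V v) a⊕b≡v))))

  ∈-+S⁻ : ∀ A B {v} → v ∈ (A +S B) → ∃₂ λ a b → a ∈ A × b ∈ B × a ⊕ b ≡ v
  ∈-+S⁻ A B {v} v∈A+B with a , _ , ∃b ← any-∈⁻ _ (allVecs n) v∈A+B
                      with b , _ , a∧b∧eq ← any-∈⁻ _ (allVecs n) ∃b =
    a , b , ∧-conicalˡ (A a) _ a∧b∧eq , ∧-conicalˡ (B b) _ b∧eq ,
    dec-true⁻ ((a ⊕ b) ≟V v) (∧-conicalʳ (B b) _ b∧eq)
    where b∧eq = ∧-conicalʳ (A a) _ a∧b∧eq

  module _ (A : Sub) (A-sub : IsSubspace A) where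

    subspace-𝟎 : 𝟎 ∈ A
    subspace-𝟎 = proj₁ A-sub

    subspace-⊕ : ∀ {u v} → u ∈ A → v ∈ A → (u ⊕ v) ∈ A
    subspace-⊕ = proj₁ (proj₂ A-sub) _ _

    subspace-· : ∀ c {v} → v ∈ A → (c · v) ∈ A
    subspace-· c = proj₂ (proj₂ A-sub) c _

    subspace-⊟ : ∀ {u w} → u ∈ A → w ∈ A → (u ⊟ w) ∈ A
    subspace-⊟ u∈A w∈A = subspace-⊕ u∈A (subspace-· (- 1#) w∈A)

  ∈-resp-≡ : ∀ A {u v} → u ∈ A → u ≡ v → v ∈ A
  ∈-resp-≡ A u∈A refl = u∈A

  ≤-+Sˡ : ∀ {A B} → IsSubspace B → A ≤ (A +S B)
  ≤-+Sˡ {A} {B} B-sub v v∈A = ∈-+S⁺ A B v∈A (subspace-𝟎 B B-sub) (⊞-identityʳ v)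

  ≤-+Sʳ : ∀ {A B} → IsSubspace A → B ≤ (A +S B)
  ≤-+Sʳ {A} {B} A-sub v v∈B = ∈-+S⁺ A B (subspace-𝟎 A A-sub) v∈B (⊞-identityˡ v)

  +S-lub : ∀ {A B C} → IsSubspace C → A ≤ C → B ≤ C → (A +S B) ≤ C
  +S-lub {A} {B} {C} C-sub A≤C B≤C v v∈A+B with a , b , a∈A , b∈B , a⊕b≡v ← ∈-+S⁻ A B v∈A+B =
    ∈-resp-≡ C (subspace-⊕ C C-sub (A≤C a a∈A) (B≤C b b∈B)) a⊕b≡v

  +S-mono : ∀ {A A′ B B′} → A ≤ A′ → B ≤ B′ → (A +S B) ≤ (A′ +S B′)
  +S-mono {A} {A′} {B} {B′} A≤A′ B≤B′ v v∈A+B with a , b , a∈A , b∈B , a⊕b≡v ← ∈-+S⁻ A B v∈A+B =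
    ∈-+S⁺ A′ B′ (A≤A′ a a∈A) (B≤B′ b b∈B) a⊕b≡v

  +S-subspace : ∀ {A B} → IsSubspace A → IsSubspace B → IsSubspace (A +S B)
  +S-subspace {A} {B} A-sub B-sub = ≤-+Sˡ {A} B-sub 𝟎 (subspace-𝟎 A A-sub) , closed-⊕ , closed-·
    where
    closed-⊕ : ∀ u v → u ∈ (A +S B) → v ∈ (A +S B) → (u ⊕ v) ∈ (A +S B)
    closed-⊕ u v u∈ v∈ with a , b , a∈A , b∈B , refl ← ∈-+S⁻ A B u∈
                       with a′ , b′ , a′∈A , b′∈B , refl ← ∈-+S⁻ A B v∈ =
      ∈-+S⁺ A B (subspace-⊕ A A-sub a∈A a′∈A) (subspace-⊕ B B-sub b∈B b′∈B) (⊞-interchange a a′ b b′)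
    closed-· : ∀ c v → v ∈ (A +S B) → (c · v) ∈ (A +S B)
    closed-· c v v∈ with a , b , a∈A , b∈B , refl ← ∈-+S⁻ A B v∈ =
      ∈-+S⁺ A B (subspace-· A A-sub c a∈A) (subspace-· B B-sub c b∈B) (sym (⊡-distribˡ c a b))

  ∩-subspace : ∀ {A B} → IsSubspace A → IsSubspace B → IsSubspace (A ∩ B)
  ∩-subspace {A} {B} A-sub B-sub =
    ∈-∩⁺ A B (subspace-𝟎 A A-sub) (subspace-𝟎 B B-sub) ,
    (λ u v u∈ v∈ → ∈-∩⁺ A B (subspace-⊕ A A-sub (∩-≤ˡ A B u u∈) (∩-≤ˡ A B v v∈))
                            (subspace-⊕ B B-sub (∩-≤ʳ A B u u∈) (∩-≤ʳ A B v v∈))) ,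
    (λ c v v∈ → ∈-∩⁺ A B (subspace-· A A-sub c (∩-≤ˡ A B v v∈)) (subspace-· B B-sub c (∩-≤ʳ A B v v∈)))

  subspace-resp-≈ : ∀ {A B} → A ≤ B → B ≤ A → IsSubspace A → IsSubspace B
  subspace-resp-≈ {A} A≤B B≤A A-sub =
    A≤B 𝟎 (subspace-𝟎 A A-sub) ,
    (λ u v u∈ v∈ → A≤B _ (subspace-⊕ A A-sub (B≤A u u∈) (B≤A v v∈))) ,
    (λ c v v∈ → A≤B _ (subspace-· A A-sub c (B≤A v v∈)))

  lincomb-∈ : ∀ A → IsSubspace A → ∀ {k} (cs : Vec (Fin q) k) {bs} → VAll.All (_∈ A) bs → lincomb cs bs ∈ A
  lincomb-∈ A A-sub []       []             = subspace-𝟎 A A-sub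
  lincomb-∈ A A-sub (c ∷ cs) (b∈A ∷ bs⊆A) =
    subspace-⊕ A A-sub (subspace-· A A-sub c b∈A) (lincomb-∈ A A-sub cs bs⊆A)

  lincomb-𝟘 : ∀ {k} (bs : Vec V k) → lincomb 𝟘 bs ≡ 𝟎
  lincomb-𝟘 []       = refl
  lincomb-𝟘 (b ∷ bs) = trans (cong₂ _⊕_ (⊡-zeroˡ b) (lincomb-𝟘 bs)) (⊞-identityˡ 𝟎)

  lincomb-⊞ : ∀ {k} (cs ds : Vec (Fin q) k) (bs : Vec V k) →
              lincomb (cs ⊞ ds) bs ≡ lincomb cs bs ⊕ lincomb ds bs
  lincomb-⊞ []       []       []       = sym (⊞-identityˡ 𝟎)
  lincomb-⊞ (c ∷ cs) (d ∷ ds) (b ∷ bs) =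
    trans (cong₂ _⊕_ (⊡-distribʳ c d b) (lincomb-⊞ cs ds bs)) (⊞-interchange (c · b) (d · b) _ _)

  lincomb-⊡ : ∀ {k} c (cs : Vec (Fin q) k) (bs : Vec V k) → lincomb (c ⊡ cs) bs ≡ c · lincomb cs bs
  lincomb-⊡ c []       []       = sym (⊡-zeroʳ c)
  lincomb-⊡ c (d ∷ cs) (b ∷ bs) =
    trans (cong₂ _⊕_ (⊡-assoc c d b) (lincomb-⊡ c cs bs)) (sym (⊡-distribˡ c (d · b) _))

  span : ∀ {k} → Vec V k → Sub
  span {k} bs v = any (λ cs → does (lincomb cs bs ≟V v)) (allVecs k)

  ∈-span⁺ : ∀ {k} (bs : Vec V k) cs {v} → lincomb cs bs ≡ v → v ∈ span bs
  ∈-span⁺ bs cs {v} eq = any-∈⁺ _ (∈-allVecs cs) (dec-true (lincomb cs bs ≟V v) eq)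

  ∈-span⁻ : ∀ {k} (bs : Vec V k) {v} → v ∈ span bs → ∃[ cs ] (lincomb cs bs ≡ v)
  ∈-span⁻ {k} bs {v} v∈span with cs , _ , eq ← any-∈⁻ _ (allVecs k) v∈span =
    cs , dec-true⁻ (lincomb cs bs ≟V v) eq

  span-subspace : ∀ {k} (bs : Vec V k) → IsSubspace (span bs)
  span-subspace bs =
    ∈-span⁺ bs 𝟘 (lincomb-𝟘 bs) ,
    (λ u v u∈ v∈ → let cs , cs↦u = ∈-span⁻ bs u∈ ; ds , ds↦v = ∈-span⁻ bs v∈ in
      ∈-span⁺ bs (cs ⊞ ds) (trans (lincomb-⊞ cs ds bs) (cong₂ _⊕_ cs↦u ds↦v))) ,
    (λ c v v∈ → let cs , cs↦v = ∈-span⁻ bs v∈ in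
      ∈-span⁺ bs (c ⊡ cs) (trans (lincomb-⊡ c cs bs) (cong (c ·_) cs↦v)))

  span-least : ∀ A → IsSubspace A → ∀ {k} {bs : Vec V k} → VAll.All (_∈ A) bs → span bs ≤ A
  span-least A A-sub {bs = bs} bs⊆A v v∈span with cs , refl ← ∈-span⁻ bs v∈span =
    lincomb-∈ A A-sub cs bs⊆A

  ⟨_⟩ : V → Sub
  ⟨ v ⟩ = span (v ∷ [])

  ⟨⟩-subspace : ∀ v → IsSubspace ⟨ v ⟩
  ⟨⟩-subspace v = span-subspace (v ∷ [])

  ∈⟨⟩⁺ : ∀ v c → (c · v) ∈ ⟨ v ⟩
  ∈⟨⟩⁺ v c = ∈-span⁺ (v ∷ []) (c ∷ []) (⊞-identityʳ (c · v))

  ∈⟨⟩⁻ : ∀ v {w} → w ∈ ⟨ v ⟩ → ∃[ c ] (c · v ≡ w)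
  ∈⟨⟩⁻ v w∈⟨v⟩ with c ∷ [] , eq ← ∈-span⁻ (v ∷ []) w∈⟨v⟩ = c , trans (sym (⊞-identityʳ (c · v))) eq

  v∈⟨v⟩ : ∀ v → v ∈ ⟨ v ⟩
  v∈⟨v⟩ v = ∈-resp-≡ ⟨ v ⟩ (∈⟨⟩⁺ v 1#) (⊡-identityˡ v)

  ⟨⟩-least : ∀ A → IsSubspace A → ∀ {v} → v ∈ A → ⟨ v ⟩ ≤ A
  ⟨⟩-least A A-sub v∈A = span-least A A-sub (v∈A ∷ [])

  subspace-·⁻¹ : ∀ A → IsSubspace A → ∀ {c v} → c ≢ 0# → (c · v) ∈ A → v ∈ A
  subspace-·⁻¹ A A-sub {c} {v} c≢0 cv∈A with d , dc≡1 ← leftInverse c≢0 =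
    ∈-resp-≡ A (subspace-· A A-sub d cv∈A) (⊡-inverse v dc≡1)

  exchange : ∀ Y → IsSubspace Y → ∀ {v w} → w ∈ (Y +S ⟨ v ⟩) → w ∉ Y → v ∈ (Y +S ⟨ w ⟩)
  exchange Y Y-sub {v} {w} w∈Y+v w∉Y
    with y , x , y∈Y , x∈⟨v⟩ , y⊕x≡w ← ∈-+S⁻ Y ⟨ v ⟩ w∈Y+v
    with c , refl ← ∈⟨⟩⁻ v x∈⟨v⟩
    with c Fin.≟ 0#
  ... | yes refl = ⊥-elim (∈∧∉⇒⊥ {Y} (∈-resp-≡ Y y∈Y y≡w) w∉Y)
    where y≡w = trans (sym (⊞-identityʳ y)) (trans (cong (y ⊕_) (sym (⊡-zeroˡ v))) y⊕x≡w)
  ... | no c≢0 = subspace-·⁻¹ (Y +S ⟨ w ⟩) (+S-subspace Y-sub (⟨⟩-subspace w)) c≢0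
      (∈-+S⁺ Y ⟨ w ⟩ (subspace-· Y Y-sub (- 1#) y∈Y) (v∈⟨v⟩ w)
        (trans (⊞-comm _ w) (sym (⊞⇒⊟ (trans (⊞-comm (c · v) y) y⊕x≡w)))))

  modular : ∀ X B {Y} → IsSubspace X → Y ≤ X → (X ∩ (B +S Y)) ≤ ((B ∩ X) +S Y)
  modular X B {Y} X-sub Y≤X w w∈
    with b , y , b∈B , y∈Y , b⊕y≡w ← ∈-+S⁻ B Y (∩-≤ʳ X (B +S Y) w w∈) =
    ∈-+S⁺ (B ∩ X) Y (∈-∩⁺ B X b∈B b∈X) y∈Y b⊕y≡w
    where b∈X = ∈-resp-≡ X (subspace-⊟ X X-sub (∩-≤ˡ X (B +S Y) w w∈) (Y≤X y y∈Y)) (sym (⊞⇒⊟ b⊕y≡w))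

  -- B is a hyperplane of A with apex v: the decidable counterpart of Codim1 B A
  infix 4 _⋖_
  _⋖_ : Sub → Sub → Set
  B ⋖ A = B ≤ A × ∃[ v ] (v ∈ A × v ∉ B × A ≤ (B +S ⟨ v ⟩))

  ⋖-any-apex : ∀ {A B} → IsSubspace B → B ⋖ A → ∀ {u} → u ∈ A → u ∉ B → A ≤ (B +S ⟨ u ⟩)
  ⋖-any-apex {A} {B} B-sub (_ , v , _ , _ , A≤B+v) {u} u∈A u∉B =
    ≤-trans A≤B+v (+S-lub B+u-sub (≤-+Sˡ {B} (⟨⟩-subspace u))
                    (⟨⟩-least (B +S ⟨ u ⟩) B+u-sub (exchange B B-sub (A≤B+v u u∈A) u∉B)))
    where B+u-sub = +S-subspace B-sub (⟨⟩-subspace u)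

  ⋖-∩ : ∀ {A B X} → IsSubspace B → IsSubspace X → B ⋖ A → X ≤ A → ∀ {v} → v ∈ X → v ∉ B → (B ∩ X) ⋖ X
  ⋖-∩ {A} {B} {X} B-sub X-sub B⋖A X≤A {v} v∈X v∉B =
    ∩-≤ʳ B X , v , v∈X , cong (_∧ X v) v∉B ,
    λ w w∈X → modular X B X-sub (⟨⟩-least X X-sub v∈X) w
                (∈-∩⁺ X (B +S ⟨ v ⟩) w∈X (⋖-any-apex B-sub B⋖A (X≤A v v∈X) v∉B w (X≤A w w∈X)))

  elements : Sub → List V
  elements A = filter (λ v → A v Bool.≟ true) (allVecs n)

  ∣_∣ : Sub → ℕ
  ∣ A ∣ = length (elements A)

  ∣∣-mono : ∀ {A B} → A ≤ B → ∣ A ∣ ℕ.≤ ∣ B ∣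
  ∣∣-mono A≤B = length-filter-mono _ _ (A≤B _) (allVecs n)

  ∣∣-mono-< : ∀ {A B v} → A ≤ B → v ∈ B → v ∉ A → ∣ A ∣ ℕ.< ∣ B ∣
  ∣∣-mono-< {A} {v = v} A≤B v∈B v∉A =
    length-filter-mono-< _ _ (A≤B _) (allVecs n) (∈-allVecs v) v∈B (λ v∈A → ∈∧∉⇒⊥ {A} v∈A v∉A)

  ≤-by-∣∣ : ∀ {A B} → A ≤ B → ∣ B ∣ ℕ.≤ ∣ A ∣ → B ≤ A
  ≤-by-∣∣ {A} {B} A≤B ∣B∣≤∣A∣ with ≤-or-escape B A
  ... | inj₁ B≤A               = B≤A
  ... | inj₂ (v , v∈B , v∉A) = contradiction ∣B∣≤∣A∣ (ℕ.<⇒≱ (∣∣-mono-< A≤B v∈B v∉A))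

  lincomb-injective : ∀ {k} {bs : Vec V k} → LinIndep bs → ∀ {cs ds} → lincomb cs bs ≡ lincomb ds bs → cs ≡ ds
  lincomb-injective {bs = bs} indep {cs} {ds} same =
    ⊞-cancelʳ cs ds ((- 1#) ⊡ ds) (trans (indep (cs ⊟ ds) combination≡𝟎) (sym (⊟-self ds)))
    where
    combination≡𝟎 : lincomb (cs ⊟ ds) bs ≡ 𝟎
    combination≡𝟎 = begin
      lincomb (cs ⊟ ds) bs                        ≡⟨ lincomb-⊞ cs _ bs ⟩
      lincomb cs bs ⊕ lincomb ((- 1#) ⊡ ds) bs    ≡⟨ cong₂ _⊕_ same (lincomb-⊡ (- 1#) ds bs) ⟩
      lincomb ds bs ⊟ lincomb ds bs               ≡⟨ ⊟-self (lincomb ds bs) ⟩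
      𝟎                                           ∎
      where open ≡-Reasoning

  -- cs ↦ lincomb cs bs is a bijection from 𝔽_q ^ k onto A
  ∣∣-HasDim : ∀ {A k} → IsSubspace A → HasDim A k → ∣ A ∣ ≡ q ℕ.^ k
  ∣∣-HasDim {A} {k} A-sub (bs , bs⊆A , indep , spanning) = begin
    ∣ A ∣                          ≡⟨ ↭-length (∼bag⇒↭ (unique∧set⇒bag
                                        (filter⁺ _ (allVecs-unique n))
                                        (map⁺ (lincomb-injective indep) (allVecs-unique k))
                                        (mk⇔ to from))) ⟩
    length (List.map combine (allVecs k)) ≡⟨ length-map combine (allVecs k) ⟩
    length (allVecs k)             ≡⟨ length-allVecs k ⟩
    q ℕ.^ k                        ∎
    where
    open ≡-Reasoning
    combine : Vec (Fin q) k → V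
    combine cs = lincomb cs bs
    to : ∀ {v} → v ∈ₗ elements A → v ∈ₗ List.map combine (allVecs k)
    to {v} v∈ with cs , refl ← spanning v (proj₂ (∈-filter⁻ (λ v → A v Bool.≟ true) {xs = allVecs n} v∈)) =
      ∈-map⁺ combine (∈-allVecs cs)
    from : ∀ {v} → v ∈ₗ List.map combine (allVecs k) → v ∈ₗ elements A
    from v∈ with cs , _ , refl ← ∈-map⁻ combine v∈ =
      ∈-filter⁺ _ (∈-allVecs _) (lincomb-∈ A A-sub cs bs⊆A)

  independent-∷ : ∀ {k} {bs : Vec V k} → LinIndep bs → ∀ {v} → v ∉ span bs → LinIndep (v ∷ bs)
  independent-∷ {bs = bs} indep {v} v∉span (c ∷ cs) c·v⊕rest≡𝟎 with c Fin.≟ 0#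
  ... | yes refl = cong (0# ∷_) (indep cs (begin
    lincomb cs bs               ≡⟨ ⊞-identityˡ _ ⟨
    𝟎 ⊕ lincomb cs bs           ≡⟨ cong (_⊕ lincomb cs bs) (⊡-zeroˡ v) ⟨
    (0# · v) ⊕ lincomb cs bs    ≡⟨ c·v⊕rest≡𝟎 ⟩
    𝟎                           ∎))
    where open ≡-Reasoning
  ... | no c≢0 = ⊥-elim (∈∧∉⇒⊥ {span bs} v∈span v∉span)
    where
    c·v∈span : (c · v) ∈ span bs
    c·v∈span = ∈-resp-≡ (span bs)
      (subspace-⊟ (span bs) (span-subspace bs) (subspace-𝟎 (span bs) (span-subspace bs)) (∈-span⁺ bs cs refl))
      (sym (⊞⇒⊟ c·v⊕rest≡𝟎))
    v∈span = subspace-·⁻¹ (span bs) (span-subspace bs) c≢0 c·v∈span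

  HasDim-resp-≈ : ∀ {A B k} → A ≤ B → B ≤ A → HasDim A k → HasDim B k
  HasDim-resp-≈ A≤B B≤A (bs , bs⊆A , indep , spanning) =
    bs , VAll.map (A≤B _) bs⊆A , indep , (λ v v∈B → spanning v (B≤A v v∈B))

  HasDim-+⟨⟩ : ∀ {B k} → IsSubspace B → HasDim B k → ∀ {v} → v ∉ B → HasDim (B +S ⟨ v ⟩) (suc k)
  HasDim-+⟨⟩ {B} B-sub (bs , bs⊆B , indep , spanning) {v} v∉B =
    v ∷ bs ,
    ≤-+Sʳ {B} B-sub v (v∈⟨v⟩ v) ∷ VAll.map (≤-+Sˡ {B} (⟨⟩-subspace v) _) bs⊆B ,
    independent-∷ indep v∉span ,
    spanning′
    where
    v∉span : v ∉ span bs
    v∉span with ∈-or-∉ (span bs) v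
    ... | inj₁ v∈span = ⊥-elim (∈∧∉⇒⊥ {B} (span-least B B-sub bs⊆B v v∈span) v∉B)
    ... | inj₂ v∉span = v∉span
    spanning′ : ∀ w → w ∈ (B +S ⟨ v ⟩) → ∃[ cs ] (lincomb cs (v ∷ bs) ≡ w)
    spanning′ w w∈ with b , x , b∈B , x∈⟨v⟩ , b⊕x≡w ← ∈-+S⁻ B ⟨ v ⟩ w∈
                   with c , refl ← ∈⟨⟩⁻ v x∈⟨v⟩
                   with ds , refl ← spanning b b∈B =
      c ∷ ds , trans (⊞-comm (c · v) _) b⊕x≡w

  basis-exists : ∀ {A} → IsSubspace A → ∃[ k ] HasDim A k
  basis-exists {A} A-sub = grow [] [] (λ { [] _ → refl }) (<-wellFounded _)
    where
    grow : ∀ {k} (bs : Vec V k) → VAll.All (_∈ A) bs → LinIndep bs →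
           Acc ℕ._<_ (∣ A ∣ ℕ.∸ ∣ span bs ∣) → ∃[ k ] HasDim A k
    grow bs bs⊆A indep (acc smaller) with ≤-or-escape A (span bs)
    ... | inj₁ A≤span = _ , bs , bs⊆A , indep , (λ v v∈A → ∈-span⁻ bs (A≤span v v∈A))
    ... | inj₂ (v , v∈A , v∉span) =
      grow (v ∷ bs) (v∈A ∷ bs⊆A) (independent-∷ indep v∉span)
           (smaller (ℕ.∸-monoʳ-< (∣∣-mono-< span≤span′ (∈-span⁺ (v ∷ bs) (1# ∷ 𝟘) v↦v) v∉span)
                                  (∣∣-mono (span-least A A-sub (v∈A ∷ bs⊆A)))))
      where
      span≤span′ : span bs ≤ span (v ∷ bs)
      span≤span′ w w∈ with cs , refl ← ∈-span⁻ bs w∈ =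
        ∈-span⁺ (v ∷ bs) (0# ∷ cs) (trans (cong (_⊕ lincomb cs bs) (⊡-zeroˡ v)) (⊞-identityˡ _))
      v↦v : lincomb (1# ∷ 𝟘) (v ∷ bs) ≡ v
      v↦v = trans (cong₂ _⊕_ (⊡-identityˡ v) (lincomb-𝟘 bs)) (⊞-identityʳ v)

  1<q : 1 ℕ.< q
  1<q = distinct⇒1< 0# 1# 0≢1
    where
    distinct⇒1< : ∀ {m} (x y : Fin m) → x ≢ y → 1 ℕ.< m
    distinct⇒1< {suc zero}    Fin.zero Fin.zero x≢y = contradiction refl x≢y
    distinct⇒1< {suc (suc m)} _        _        _   = ℕ.s≤s (ℕ.s≤s ℕ.z≤n)

  Codim1⇒⋖ : ∀ {A B} → IsSubspace A → IsSubspace B → Codim1 B A → B ⋖ A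
  Codim1⇒⋖ {A} {B} A-sub B-sub (B≤A , k , dimA , dimB) with ≤-or-escape A B
  ... | inj₁ A≤B = contradiction (∣∣-mono A≤B) (ℕ.<⇒≱ ∣B∣<∣A∣)
    where
    ∣B∣<∣A∣ : ∣ B ∣ ℕ.< ∣ A ∣
    ∣B∣<∣A∣ = subst₂ ℕ._<_ (sym (∣∣-HasDim B-sub dimB)) (sym (∣∣-HasDim A-sub dimA))
                (ℕ.^-monoʳ-< q 1<q (ℕ.n<1+n k))
  ... | inj₂ (v , v∈A , v∉B) = B≤A , v , v∈A , v∉B ,
    ≤-by-∣∣ (+S-lub A-sub B≤A (⟨⟩-least A A-sub v∈A))
      (ℕ.≤-reflexive (trans (∣∣-HasDim A-sub dimA)
        (sym (∣∣-HasDim (+S-subspace B-sub (⟨⟩-subspace v)) (HasDim-+⟨⟩ B-sub dimB v∉B)))))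

  ⋖⇒Codim1 : ∀ {A B} → IsSubspace A → IsSubspace B → B ⋖ A → Codim1 B A
  ⋖⇒Codim1 {A} A-sub B-sub (B≤A , v , v∈A , v∉B , A≤B+v) with k , dimB ← basis-exists B-sub =
    B≤A , k , HasDim-resp-≈ (+S-lub A-sub B≤A (⟨⟩-least A A-sub v∈A)) A≤B+v (HasDim-+⟨⟩ B-sub dimB v∉B) ,
    dimB

  ⟨⟩-point : ∀ {v} → v ≢ 𝟎 → IsPoint ⟨ v ⟩
  ⟨⟩-point {v} v≢𝟎 = ⟨⟩-subspace v , v ∷ [] , v∈⟨v⟩ v ∷ [] , independent , (λ w → ∈-span⁻ (v ∷ []))
    where
    independent : LinIndep (v ∷ [])
    independent (c ∷ []) c·v⊕𝟎≡𝟎 with c Fin.≟ 0#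
    ... | yes c≡0 = cong (_∷ []) c≡0
    ... | no c≢0  = contradiction (⊡-cancel c≢0 (trans (sym (⊞-identityʳ (c · v))) c·v⊕𝟎≡𝟎)) v≢𝟎

  ⟨𝟎⟩-HasDim : HasDim ⟨ 𝟎 ⟩ 0
  ⟨𝟎⟩-HasDim = [] , [] , (λ { [] _ → refl }) , spanning
    where
    spanning : ∀ w → w ∈ ⟨ 𝟎 ⟩ → ∃[ cs ] (lincomb cs [] ≡ w)
    spanning w w∈ with c , c·𝟎≡w ← ∈⟨⟩⁻ 𝟎 w∈ = [] , trans (sym (⊡-zeroʳ c)) c·𝟎≡w

  ≤? : ∀ A B → Dec (A ≤ B)
  ≤? A B = all?-complete ∈-allVecs (λ v → (A v Bool.≟ true) →-dec (B v Bool.≟ true))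

  subspace? : ∀ A → Dec (IsSubspace A)
  subspace? A =
    (A 𝟎 Bool.≟ true) ×-dec
    all?-complete ∈-allVecs (λ u → all?-complete ∈-allVecs (λ v →
      (A u Bool.≟ true) →-dec ((A v Bool.≟ true) →-dec (A (u ⊕ v) Bool.≟ true)))) ×-dec
    all?-complete ∈-allFin (λ c → all?-complete ∈-allVecs (λ v →
      (A v Bool.≟ true) →-dec (A (c · v) Bool.≟ true)))

  ⋖? : ∀ B A → Dec (B ⋖ A)
  ⋖? B A = ≤? B A ×-dec any?-complete ∈-allVecs (λ v →
    (A v Bool.≟ true) ×-dec (B v Bool.≟ false) ×-dec ≤? A (B +S ⟨ v ⟩))

  fromList : List V → Sub
  fromList vs v = does (_∈?_ _≟V_ v vs)

  ∃-subset? : {P : Sub → Set} → (∀ {A B} → A ≤ B → B ≤ A → P A → P B) →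
              (∀ A → Dec (P A)) → Dec (∃ P)
  ∃-subset? {P} resp P? with Any.any? (λ vs → P? (fromList vs)) (sublists (allVecs n))
  ... | yes found = yes (_ , proj₂ (Any.satisfied found))
  ... | no ¬found = no λ (A , pA) →
    ¬found (Any.map (λ { refl → resp A≤ ≤A pA }) (filter-∈-sublists _ (allVecs n)))
    where
    A≤ : ∀ {A} → A ≤ fromList (elements A)
    A≤ v v∈A = dec-true (_∈?_ _≟V_ v _) (∈-filter⁺ _ (∈-allVecs v) v∈A)
    ≤A : ∀ {A} → fromList (elements A) ≤ A
    ≤A {A} v v∈ = proj₂ (∈-filter⁻ (λ v → A v Bool.≟ true) {xs = allVecs n} (dec-true⁻ (_∈?_ _≟V_ v _) v∈))

+-cancelʳ-≤ : ∀ i {j k} → j ℤ.+ i ℤ.≤ k ℤ.+ i → j ℤ.≤ k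
+-cancelʳ-≤ i {j} {k} j+i≤k+i with j ℤ.≤? k
... | yes j≤k = j≤k
... | no  j≰k = contradiction j+i≤k+i (ℤ.<⇒≱ (ℤ.+-monoˡ-< i (ℤ.≰⇒> j≰k)))

+-cancelʳ-< : ∀ i {j k} → j ℤ.+ i ℤ.< k ℤ.+ i → j ℤ.< k
+-cancelʳ-< i {j} {k} j+i<k+i with j ℤ.<? k
... | yes j<k = j<k
... | no  j≮k = contradiction (ℤ.+-monoˡ-≤ i (ℤ.≮⇒≥ j≮k)) (ℤ.<⇒≱ j+i<k+i)

module RankTheory {q : ℕ} (𝔽 : FiniteField q) (n : ℕ) (r : Setting.Sub 𝔽 n → ℤ) (QM : Setting.IsQMatroid 𝔽 n r) where

  open Setting 𝔽 n
  open IsQMatroid QM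
  open VectorAlgebra 𝔽
  open Subspaces 𝔽 n

  rank-mono : ∀ {A B} → IsSubspace A → IsSubspace B → A ≤ B → r A ℤ.≤ r B
  rank-mono = R2 _ _

  rank-cong : ∀ {A B} → IsSubspace A → IsSubspace B → A ≤ B → B ≤ A → r A ≡ r B
  rank-cong A-sub B-sub A≤B B≤A = ℤ.≤-antisym (rank-mono A-sub B-sub A≤B) (rank-mono B-sub A-sub B≤A)

  rank-+S-≤ : ∀ {A B} → IsSubspace A → IsSubspace B → B ≤ A → r (A +S B) ≡ r A
  rank-+S-≤ {A} A-sub B-sub B≤A =
    rank-cong (+S-subspace A-sub B-sub) A-sub (+S-lub A-sub ≤-refl B≤A) (≤-+Sˡ {A} B-sub)

  rank-⟨⟩≤1 : ∀ v → r ⟨ v ⟩ ℤ.≤ 1ℤ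
  rank-⟨⟩≤1 v with v ≟V 𝟎
  ... | yes refl = ℤ.≤-trans (R1-dim ⟨ 𝟎 ⟩ 0 (⟨⟩-subspace 𝟎) ⟨𝟎⟩-HasDim) (ℤ.+≤+ ℕ.z≤n)
  ... | no v≢𝟎   = R1-dim ⟨ v ⟩ 1 (⟨⟩-subspace v) (proj₂ (⟨⟩-point v≢𝟎))

  rank-+⟨⟩ : ∀ {Y} → IsSubspace Y → ∀ w → r (Y +S ⟨ w ⟩) ℤ.≤ ℤ.suc (r Y)
  rank-+⟨⟩ {Y} Y-sub w = begin
    r (Y +S ⟨ w ⟩)                       ≡⟨ ℤ.+-identityʳ _ ⟨
    r (Y +S ⟨ w ⟩) ℤ.+ 0ℤ                ≤⟨ ℤ.+-monoʳ-≤ (r (Y +S ⟨ w ⟩))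
                                               (R1-nonneg _ (∩-subspace Y-sub (⟨⟩-subspace w))) ⟩
    r (Y +S ⟨ w ⟩) ℤ.+ r (Y ∩ ⟨ w ⟩)     ≤⟨ R3 Y ⟨ w ⟩ Y-sub (⟨⟩-subspace w) ⟩
    r Y ℤ.+ r ⟨ w ⟩                      ≤⟨ ℤ.+-monoʳ-≤ (r Y) (rank-⟨⟩≤1 w) ⟩
    r Y ℤ.+ 1ℤ                           ≡⟨ ℤ.+-comm (r Y) 1ℤ ⟩
    ℤ.suc (r Y)                          ∎
    where open ℤ.≤-Reasoning

  rank-unchanged-upward : ∀ {A X Y} → IsSubspace A → IsSubspace X → IsSubspace Y → A ≤ X →
                          r (A +S Y) ≡ r A → r (X +S Y) ≡ r X
  rank-unchanged-upward {A} {X} {Y} A-sub X-sub Y-sub A≤X rA+Y≡rA =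
    ℤ.≤-antisym (+-cancelʳ-≤ (r A) (begin
      r (X +S Y) ℤ.+ r A                          ≤⟨ ℤ.+-mono-≤ (rank-mono X+Y-sub X+[A+Y]-sub X+Y≤)
                                                                 (rank-mono A-sub X∩[A+Y]-sub A≤) ⟩
      r (X +S (A +S Y)) ℤ.+ r (X ∩ (A +S Y))      ≤⟨ R3 X (A +S Y) X-sub A+Y-sub ⟩
      r X ℤ.+ r (A +S Y)                          ≡⟨ cong (ℤ._+_ (r X)) rA+Y≡rA ⟩
      r X ℤ.+ r A                                 ∎))
      (rank-mono X-sub X+Y-sub (≤-+Sˡ {X} Y-sub))
    where
    open ℤ.≤-Reasoning
    A+Y-sub       = +S-subspace A-sub Y-sub
    X+Y-sub       = +S-subspace X-sub Y-sub
    X+[A+Y]-sub   = +S-subspace X-sub A+Y-sub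
    X∩[A+Y]-sub   = ∩-subspace X-sub A+Y-sub
    X+Y≤ : (X +S Y) ≤ (X +S (A +S Y))
    X+Y≤ = +S-mono {X} ≤-refl (≤-+Sʳ {A} A-sub)
    A≤ : A ≤ (X ∩ (A +S Y))
    A≤ = ∩-glb A≤X (≤-+Sˡ {A} Y-sub)

  rank-drop-∩ : ∀ {A B X} → IsSubspace A → IsSubspace B → IsSubspace X → B ⋖ A → r B ℤ.< r A →
                X ≤ A → ∀ {v} → v ∈ X → v ∉ B → r (B ∩ X) ℤ.< r X
  rank-drop-∩ {A} {B} {X} A-sub B-sub X-sub B⋖A rB<rA X≤A {v} v∈X v∉B = +-cancelʳ-< (r A) (begin-strict
    r (B ∩ X) ℤ.+ r A               ≡⟨ ℤ.+-comm (r (B ∩ X)) (r A) ⟩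
    r A ℤ.+ r (B ∩ X)               ≤⟨ ℤ.+-monoˡ-≤ (r (B ∩ X)) (rank-mono A-sub B+X-sub A≤B+X) ⟩
    r (B +S X) ℤ.+ r (B ∩ X)        ≤⟨ R3 B X B-sub X-sub ⟩
    r B ℤ.+ r X                     <⟨ ℤ.+-monoˡ-< (r X) rB<rA ⟩
    r A ℤ.+ r X                     ≡⟨ ℤ.+-comm (r A) (r X) ⟩
    r X ℤ.+ r A                     ∎)
    where
    open ℤ.≤-Reasoning
    B+X-sub = +S-subspace B-sub X-sub
    A≤B+X : A ≤ (B +S X)
    A≤B+X = ≤-trans (⋖-any-apex B-sub B⋖A (X≤A v v∈X) v∉B)
                    (+S-mono {B} ≤-refl (⟨⟩-least X X-sub v∈X))

  flat-intro : ∀ {X} → IsSubspace X → (∀ x → IsPoint x → r (X +S x) ≡ r X → x ≤ X) → IsFlat r X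
  flat-intro {X} X-sub closed = X-sub , rank-rises
    where
    rank-rises : ∀ x → IsPoint x → ¬ (x ≤ X) → r X ℤ.< r (X +S x)
    rank-rises x x-point@(x-sub , _) x≰X with r X ℤ.<? r (X +S x)
    ... | yes rX<rX+x = rX<rX+x
    ... | no  rX≮rX+x = contradiction (closed x x-point
          (ℤ.≤-antisym (ℤ.≮⇒≥ rX≮rX+x) (rank-mono X-sub (+S-subspace X-sub x-sub) (≤-+Sˡ {X} x-sub)))) x≰X

  flat-elim : ∀ {F A x} → IsFlat r F → IsSubspace A → A ≤ F → IsPoint x → r (A +S x) ≡ r A → x ≤ F
  flat-elim {F} {A} {x} (F-sub , rank-rises) A-sub A≤F x-point@(x-sub , _) rA+x≡rA with ≤? x F
  ... | yes x≤F = x≤F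
  ... | no  x≰F = ⊥-elim (ℤ.<-irrefl (sym (rank-unchanged-upward A-sub F-sub x-sub A≤F rA+x≡rA))
                                      (rank-rises x x-point x≰F))

  ∩-flat : ∀ {F₁ F₂} → IsFlat r F₁ → IsFlat r F₂ → IsFlat r (F₁ ∩ F₂)
  ∩-flat {F₁} {F₂} F₁-flat F₂-flat = flat-intro F₁∩F₂-sub λ x x-point rank≡ →
    ∩-glb (flat-elim F₁-flat F₁∩F₂-sub (∩-≤ˡ F₁ F₂) x-point rank≡)
          (flat-elim F₂-flat F₁∩F₂-sub (∩-≤ʳ F₁ F₂) x-point rank≡)
    where F₁∩F₂-sub = ∩-subspace (proj₁ F₁-flat) (proj₁ F₂-flat)

  cyclic-intro : ∀ {A} → IsSubspace A → (∀ K → IsSubspace K → K ⋖ A → r A ℤ.≤ r K) → IsCyclic r A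
  cyclic-intro A-sub full-rank = A-sub , λ K K-sub K-codim1 →
    ℤ.≤-antisym (rank-mono K-sub A-sub (proj₁ K-codim1)) (full-rank K K-sub (Codim1⇒⋖ A-sub K-sub K-codim1))

  -- W ≤ K + Z, and r (K + Z) ≤ r K by submodularity since the hyperplane K ∩ Z of Z has the rank of Z
  full-rank-⋖ : ∀ {W K Z} → IsCyclic r Z → IsSubspace W → IsSubspace K → K ⋖ W → Z ≤ W →
                ∀ {z} → z ∈ Z → z ∉ K → r W ℤ.≤ r K
  full-rank-⋖ {W} {K} {Z} (Z-sub , Z-cyclic) W-sub K-sub K⋖W Z≤W {z} z∈Z z∉K = begin
    r W         ≤⟨ rank-mono W-sub K+Z-sub W≤K+Z ⟩
    r (K +S Z)  ≤⟨ +-cancelʳ-≤ (r Z) (begin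
                     r (K +S Z) ℤ.+ r Z         ≡⟨ cong (ℤ._+_ (r (K +S Z))) rK∩Z≡rZ ⟨
                     r (K +S Z) ℤ.+ r (K ∩ Z)   ≤⟨ R3 K Z K-sub Z-sub ⟩
                     r K ℤ.+ r Z                ∎) ⟩
    r K         ∎
    where
    open ℤ.≤-Reasoning
    K+Z-sub = +S-subspace K-sub Z-sub
    K∩Z-sub = ∩-subspace K-sub Z-sub
    W≤K+Z : W ≤ (K +S Z)
    W≤K+Z = ≤-trans (⋖-any-apex K-sub K⋖W (Z≤W z z∈Z) z∉K) (+S-mono {K} ≤-refl (⟨⟩-least Z Z-sub z∈Z))
    rK∩Z≡rZ : r (K ∩ Z) ≡ r Z
    rK∩Z≡rZ = Z-cyclic (K ∩ Z) K∩Z-sub (⋖⇒Codim1 Z-sub K∩Z-sub (⋖-∩ K-sub Z-sub K⋖W Z≤W z∈Z z∉K))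

  +S-cyclic : ∀ {Z₁ Z₂} → IsCyclic r Z₁ → IsCyclic r Z₂ → IsCyclic r (Z₁ +S Z₂)
  +S-cyclic {Z₁} {Z₂} Z₁-cyclic Z₂-cyclic = cyclic-intro Z-sub full-rank
    where
    Z₁-sub = proj₁ Z₁-cyclic
    Z₂-sub = proj₁ Z₂-cyclic
    Z-sub = +S-subspace Z₁-sub Z₂-sub
    full-rank : ∀ K → IsSubspace K → K ⋖ (Z₁ +S Z₂) → r (Z₁ +S Z₂) ℤ.≤ r K
    full-rank K K-sub K⋖Z with ≤-or-escape Z₁ K | ≤-or-escape Z₂ K
    ... | inj₂ (z , z∈Z₁ , z∉K) | _ = full-rank-⋖ Z₁-cyclic Z-sub K-sub K⋖Z (≤-+Sˡ {Z₁} Z₂-sub) z∈Z₁ z∉K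
    ... | inj₁ _ | inj₂ (z , z∈Z₂ , z∉K) = full-rank-⋖ Z₂-cyclic Z-sub K-sub K⋖Z (≤-+Sʳ {Z₁} Z₁-sub) z∈Z₂ z∉K
    ... | inj₁ Z₁≤K | inj₁ Z₂≤K with _ , v , v∈Z , v∉K , _ ← K⋖Z =
      ⊥-elim (∈∧∉⇒⊥ {K} (+S-lub K-sub Z₁≤K Z₂≤K v v∈Z) v∉K)

  sumOfPoints-intro : ∀ {P : Sub → Set} {C} → IsSubspace C → (∀ x → IsPoint x → P x → x ≤ C) →
                      (∀ {v} → v ∈ C → v ≢ 𝟎 → P ⟨ v ⟩) → IsSumOfPoints r P C
  sumOfPoints-intro {P} {C} C-sub contains generates = C-sub , contains , least
    where
    least : ∀ D → IsSubspace D → (∀ x → IsPoint x → P x → x ≤ D) → C ≤ D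
    least D D-sub D-contains v v∈C with v ≟V 𝟎
    ... | yes refl = subspace-𝟎 D D-sub
    ... | no  v≢𝟎  = D-contains ⟨ v ⟩ (⟨⟩-point v≢𝟎) (generates v∈C v≢𝟎) v (v∈⟨v⟩ v)

  module Closure {S : Sub} (S-sub : IsSubspace S) where

    cl : Sub
    cl v = does (r (S +S ⟨ v ⟩) ℤ.≟ r S)

    ∈-cl⁻ : ∀ {v} → v ∈ cl → r (S +S ⟨ v ⟩) ≡ r S
    ∈-cl⁻ {v} = dec-true⁻ (r (S +S ⟨ v ⟩) ℤ.≟ r S)

    ∈-cl⁺ : ∀ {v T} → IsSubspace T → (S +S ⟨ v ⟩) ≤ T → r T ℤ.≤ r S → v ∈ cl
    ∈-cl⁺ {v} T-sub S+v≤T rT≤rS = dec-true (r (S +S ⟨ v ⟩) ℤ.≟ r S) (ℤ.≤-antisym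
      (ℤ.≤-trans (rank-mono (+S-subspace S-sub (⟨⟩-subspace v)) T-sub S+v≤T) rT≤rS)
      (rank-mono S-sub (+S-subspace S-sub (⟨⟩-subspace v)) (≤-+Sˡ {S} (⟨⟩-subspace v))))

    S≤cl : S ≤ cl
    S≤cl v v∈S = ∈-cl⁺ S-sub (+S-lub S-sub ≤-refl (⟨⟩-least S S-sub v∈S)) ℤ.≤-refl

    cl-subspace : IsSubspace cl
    cl-subspace = S≤cl 𝟎 (subspace-𝟎 S S-sub) , closed-⊕ , closed-·
      where
      closed-⊕ : ∀ u v → u ∈ cl → v ∈ cl → (u ⊕ v) ∈ cl
      closed-⊕ u v u∈cl v∈cl = ∈-cl⁺ S+u+v-sub
        (+S-lub S+u+v-sub (≤-trans (≤-+Sˡ {S} (⟨⟩-subspace u)) (≤-+Sˡ {S +S ⟨ u ⟩} (⟨⟩-subspace v)))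
          (⟨⟩-least _ S+u+v-sub (subspace-⊕ _ S+u+v-sub
            (≤-+Sˡ {S +S ⟨ u ⟩} (⟨⟩-subspace v) u (≤-+Sʳ {S} S-sub u (v∈⟨v⟩ u)))
            (≤-+Sʳ {S +S ⟨ u ⟩} S+u-sub v (v∈⟨v⟩ v)))))
        (ℤ.≤-reflexive (trans (rank-unchanged-upward S-sub S+u-sub (⟨⟩-subspace v) (≤-+Sˡ {S} (⟨⟩-subspace u))
                                (∈-cl⁻ v∈cl))
                              (∈-cl⁻ u∈cl)))
        where
        S+u-sub   = +S-subspace S-sub (⟨⟩-subspace u)
        S+u+v-sub = +S-subspace S+u-sub (⟨⟩-subspace v)
      closed-· : ∀ c v → v ∈ cl → (c · v) ∈ cl
      closed-· c v v∈cl = ∈-cl⁺ (+S-subspace S-sub (⟨⟩-subspace v))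
        (+S-mono {S} ≤-refl (⟨⟩-least ⟨ v ⟩ (⟨⟩-subspace v) (∈⟨⟩⁺ v c))) (ℤ.≤-reflexive (∈-cl⁻ v∈cl))

    cl-absorbed : ∀ vs → ∃[ T ] (IsSubspace T × S ≤ T × r T ≡ r S × (∀ v → v ∈ₗ vs → v ∈ cl → v ∈ T))
    cl-absorbed []       = S , S-sub , ≤-refl , refl , λ _ ()
    cl-absorbed (v ∷ vs) with T , T-sub , S≤T , rT≡rS , covers ← cl-absorbed vs | ∈-or-∉ cl v
    ... | inj₁ v∈cl = T +S ⟨ v ⟩ , +S-subspace T-sub (⟨⟩-subspace v) ,
          ≤-trans S≤T (≤-+Sˡ {T} (⟨⟩-subspace v)) ,
          trans (rank-unchanged-upward S-sub T-sub (⟨⟩-subspace v) S≤T (∈-cl⁻ v∈cl)) rT≡rS ,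
          λ { w (here refl) _ → ≤-+Sʳ {T} T-sub w (v∈⟨v⟩ w)
            ; w (there w∈vs) w∈cl → ≤-+Sˡ {T} (⟨⟩-subspace v) w (covers w w∈vs w∈cl) }
    ... | inj₂ v∉cl = T , T-sub , S≤T , rT≡rS ,
          λ { w (here refl) w∈cl → ⊥-elim (∈∧∉⇒⊥ {cl} w∈cl v∉cl)
            ; w (there w∈vs) w∈cl → covers w w∈vs w∈cl }

    rank-cl : r cl ≡ r S
    rank-cl with T , T-sub , S≤T , rT≡rS , covers ← cl-absorbed (allVecs n) =
      ℤ.≤-antisym (ℤ.≤-trans (rank-mono cl-subspace T-sub (λ v → covers v (∈-allVecs v))) (ℤ.≤-reflexive rT≡rS))
                  (rank-mono S-sub cl-subspace S≤cl)

    cl-flat : IsFlat r cl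
    cl-flat = flat-intro cl-subspace λ x (x-sub , _) rcl+x≡rcl w w∈x →
      ∈-cl⁺ (+S-subspace cl-subspace x-sub) (+S-mono S≤cl (⟨⟩-least x x-sub w∈x))
            (ℤ.≤-reflexive (trans rcl+x≡rcl rank-cl))

    cl-IsCl : IsCl r S cl
    cl-IsCl = sumOfPoints-intro cl-subspace
      (λ x (x-sub , _) rS+x≡rS w w∈x → ∈-cl⁺ (+S-subspace S-sub x-sub)
          (+S-mono {S} ≤-refl (⟨⟩-least x x-sub w∈x)) (ℤ.≤-reflexive rS+x≡rS))
      (λ v∈cl _ → ∈-cl⁻ v∈cl)

    cl-least : ∀ {F} → IsFlat r F → S ≤ F → cl ≤ F
    cl-least {F} F-flat S≤F v v∈cl with v ≟V 𝟎
    ... | yes refl = subspace-𝟎 F (proj₁ F-flat)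
    ... | no  v≢𝟎  = flat-elim F-flat S-sub S≤F (⟨⟩-point v≢𝟎) (∈-cl⁻ v∈cl) v (v∈⟨v⟩ v)

    cl-cyclic : IsCyclic r S → IsCyclic r cl
    cl-cyclic S-cyclic = cyclic-intro cl-subspace full-rank
      where
      full-rank : ∀ K → IsSubspace K → K ⋖ cl → r cl ℤ.≤ r K
      full-rank K K-sub K⋖cl with ≤-or-escape S K
      ... | inj₁ S≤K = ℤ.≤-trans (ℤ.≤-reflexive rank-cl) (rank-mono S-sub K-sub S≤K)
      ... | inj₂ (z , z∈S , z∉K) = full-rank-⋖ S-cyclic cl-subspace K-sub K⋖cl S≤cl z∈S z∉K

  RankDroppingHyperplane : Sub → Sub → Set
  RankDroppingHyperplane B A = IsSubspace B × B ⋖ A × r B ℤ.< r A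

  rankDroppingHyperplane? : ∀ B A → Dec (RankDroppingHyperplane B A)
  rankDroppingHyperplane? B A = subspace? B ×-dec ⋖? B A ×-dec (r B ℤ.<? r A)

  rankDroppingHyperplane-resp-≈ : ∀ {A B B′} → B ≤ B′ → B′ ≤ B →
                                  RankDroppingHyperplane B A → RankDroppingHyperplane B′ A
  rankDroppingHyperplane-resp-≈ {A} {B} {B′} B≤B′ B′≤B (B-sub , (B≤A , v , v∈A , v∉B , A≤B+v) , rB<rA) =
    B′-sub , (≤-trans B′≤B B≤A , v , v∈A , v∉B′ , ≤-trans A≤B+v (+S-mono B≤B′ ≤-refl)) ,
    subst (ℤ._< r A) (rank-cong B-sub B′-sub B≤B′ B′≤B) rB<rA
    where
    B′-sub = subspace-resp-≈ B≤B′ B′≤B B-sub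
    v∉B′ : v ∉ B′
    v∉B′ with ∈-or-∉ B′ v
    ... | inj₁ v∈B′ = ⊥-elim (∈∧∉⇒⊥ {B} (B′≤B v v∈B′) v∉B)
    ... | inj₂ v∉B′ = v∉B′

  module CyclicCore {A : Sub} (A-sub : IsSubspace A) where

    -- opaque, as unfolding this exhaustive search makes type checking very slow
    opaque
      escape? : ∀ v → Dec (∃[ B ] (RankDroppingHyperplane B A × v ∉ B))
      escape? v = ∃-subset? escape-resp-≈ (λ B → rankDroppingHyperplane? B A ×-dec (B v Bool.≟ false))
        where
        escape-resp-≈ : ∀ {B B′} → B ≤ B′ → B′ ≤ B → RankDroppingHyperplane B A × v ∉ B → RankDroppingHyperplane B′ A × v ∉ B′
        escape-resp-≈ {B} {B′} B≤B′ B′≤B (B-rdh , v∉B) with ∈-or-∉ B′ v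
        ... | inj₁ v∈B′ = ⊥-elim (∈∧∉⇒⊥ {B} (B′≤B v v∈B′) v∉B)
        ... | inj₂ v∉B′ = rankDroppingHyperplane-resp-≈ B≤B′ B′≤B B-rdh , v∉B′

    cyc : Sub
    cyc v = A v ∧ not (does (escape? v))

    cyc-≤ : cyc ≤ A
    cyc-≤ v = ∧-conicalˡ (A v) _

    cyc-≤-rankDropping : ∀ {B} → RankDroppingHyperplane B A → cyc ≤ B
    cyc-≤-rankDropping {B} B-rdh v v∈cyc with escape? v | ∈-or-∉ B v
    ... | _          | inj₁ v∈B = v∈B
    ... | no ¬escape | inj₂ v∉B = ⊥-elim (¬escape (B , B-rdh , v∉B))
    ... | yes _      | inj₂ _   with () ← ∧-conicalʳ (A v) false v∈cyc

    ∈-cyc⁺ : ∀ {v} → v ∈ A → (∀ B → RankDroppingHyperplane B A → v ∈ B) → v ∈ cyc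
    ∈-cyc⁺ {v} v∈A in-all with escape? v
    ... | no _                  = ∧-true v∈A refl
    ... | yes (B , B-rdh , v∉B) = ⊥-elim (∈∧∉⇒⊥ {B} (in-all B B-rdh) v∉B)

    ∉-cyc : ∀ {v} → v ∈ A → v ∉ cyc → ∃[ B ] (RankDroppingHyperplane B A × v ∉ B)
    ∉-cyc {v} v∈A v∉cyc with escape? v
    ... | yes escape = escape
    ... | no _       with () ← trans (sym (∧-true v∈A refl)) v∉cyc

    cyc-subspace : IsSubspace cyc
    cyc-subspace =
      ∈-cyc⁺ (subspace-𝟎 A A-sub) (λ B (B-sub , _) → subspace-𝟎 B B-sub) ,
      (λ u v u∈ v∈ → ∈-cyc⁺ (subspace-⊕ A A-sub (cyc-≤ u u∈) (cyc-≤ v v∈)) λ B B-rdh →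
        subspace-⊕ B (proj₁ B-rdh) (cyc-≤-rankDropping B-rdh u u∈) (cyc-≤-rankDropping B-rdh v v∈)) ,
      (λ c v v∈ → ∈-cyc⁺ (subspace-· A A-sub c (cyc-≤ v v∈)) λ B B-rdh →
        subspace-· B (proj₁ B-rdh) c (cyc-≤-rankDropping B-rdh v v∈))

    cyc-IsCyc : IsCyc r A cyc
    cyc-IsCyc = sumOfPoints-intro cyc-subspace contains generates
      where
      contains : ∀ x → IsPoint x → x ≤ A × (∀ B → IsSubspace B → Codim1 B A → r (B +S x) ≡ r B) → x ≤ cyc
      contains x (x-sub , _) (x≤A , absorbed) w w∈x = ∈-cyc⁺ (x≤A w w∈x) in-every
        where
        in-every : ∀ B → RankDroppingHyperplane B A → w ∈ B
        in-every B (B-sub , B⋖A , rB<rA) with ∈-or-∉ B w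
        ... | inj₁ w∈B = w∈B
        ... | inj₂ w∉B = ⊥-elim (ℤ.<⇒≱ rB<rA (begin
          r A          ≤⟨ rank-mono A-sub (+S-subspace B-sub x-sub) (≤-trans
                            (⋖-any-apex B-sub B⋖A (x≤A w w∈x) w∉B) (+S-mono {B} ≤-refl (⟨⟩-least x x-sub w∈x))) ⟩
          r (B +S x)   ≡⟨ absorbed B B-sub (⋖⇒Codim1 A-sub B-sub B⋖A) ⟩
          r B          ∎))
          where open ℤ.≤-Reasoning
      generates : ∀ {v} → v ∈ cyc → v ≢ 𝟎 →
                  ⟨ v ⟩ ≤ A × (∀ B → IsSubspace B → Codim1 B A → r (B +S ⟨ v ⟩) ≡ r B)
      generates {v} v∈cyc _ = ⟨⟩-least A A-sub (cyc-≤ v v∈cyc) , absorbed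
        where
        absorbed : ∀ B → IsSubspace B → Codim1 B A → r (B +S ⟨ v ⟩) ≡ r B
        absorbed B B-sub B-codim1 with ∈-or-∉ B v | r B ℤ.<? r A
        ... | inj₁ v∈B | _ = rank-+S-≤ B-sub (⟨⟩-subspace v) (⟨⟩-least B B-sub v∈B)
        ... | inj₂ v∉B | yes rB<rA =
          ⊥-elim (∈∧∉⇒⊥ {B} (cyc-≤-rankDropping (B-sub , Codim1⇒⋖ A-sub B-sub B-codim1 , rB<rA) v v∈cyc) v∉B)
        ... | inj₂ _   | no rB≮rA = ℤ.≤-antisym
          (ℤ.≤-trans (rank-mono B+v-sub A-sub (+S-lub A-sub (proj₁ B-codim1) (⟨⟩-least A A-sub (cyc-≤ v v∈cyc))))
                     (ℤ.≮⇒≥ rB≮rA))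
          (rank-mono B-sub B+v-sub (≤-+Sˡ {B} (⟨⟩-subspace v)))
          where B+v-sub = +S-subspace B-sub (⟨⟩-subspace v)

    cyc-flat : IsFlat r A → IsFlat r cyc
    cyc-flat A-flat = flat-intro cyc-subspace closed
      where
      closed : ∀ x → IsPoint x → r (cyc +S x) ≡ r cyc → x ≤ cyc
      closed x x-point rcyc+x≡rcyc = inside (flat-elim A-flat cyc-subspace cyc-≤ x-point rcyc+x≡rcyc)
        where
        x-sub = proj₁ x-point
        X-sub = +S-subspace cyc-subspace x-sub
        inside : x ≤ A → x ≤ cyc
        inside x≤A w w∈x with ∈-or-∉ cyc w
        ... | inj₁ w∈cyc = w∈cyc
        ... | inj₂ w∉cyc with B , B-rdh@(B-sub , B⋖A , rB<rA) , w∉B ← ∉-cyc (x≤A w w∈x) w∉cyc =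
          ⊥-elim (ℤ.<-irrefl (sym rcyc+x≡rcyc) (ℤ.≤-<-trans
            (rank-mono cyc-subspace (∩-subspace B-sub X-sub) (∩-glb (cyc-≤-rankDropping B-rdh) (≤-+Sˡ {cyc} x-sub)))
            (rank-drop-∩ A-sub B-sub X-sub B⋖A rB<rA (+S-lub A-sub cyc-≤ x≤A) (≤-+Sʳ {cyc} cyc-subspace w w∈x) w∉B)))

    cyclic-≤-cyc : ∀ {G} → IsCyclic r G → G ≤ A → G ≤ cyc
    cyclic-≤-cyc G-cyclic G≤A v v∈G = ∈-cyc⁺ (G≤A v v∈G) in-every
      where
      in-every : ∀ B → RankDroppingHyperplane B A → v ∈ B
      in-every B (B-sub , B⋖A , rB<rA) with ∈-or-∉ B v
      ... | inj₁ v∈B = v∈B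
      ... | inj₂ v∉B = ⊥-elim (ℤ.<⇒≱ rB<rA (full-rank-⋖ G-cyclic A-sub B-sub B⋖A G≤A v∈G v∉B))

    Liftable : Sub → Set
    Liftable X = ∀ K → RankDroppingHyperplane K X →
                 ∃[ B ] (RankDroppingHyperplane B A × K ≤ B × ∃[ u ] (u ∈ X × u ∉ B))

    liftable-A : Liftable A
    liftable-A K K-rdh@(_ , (_ , u , u∈A , u∉K , _) , _) = K , K-rdh , ≤-refl , u , u∈A , u∉K

    -- K′ + ⟨v⟩ is a rank-dropping hyperplane of X, and its lift misses the apex u′ of K′
    liftable-∩ : ∀ {X B} → IsSubspace X → X ≤ A → RankDroppingHyperplane B A → ∀ {v} → v ∈ X → v ∉ B →
                 Liftable X → Liftable (B ∩ X)
    liftable-∩ {X} {B} X-sub X≤A (B-sub , B⋖A , rB<rA) {v} v∈X v∉B lift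
               K′ (K′-sub , (K′≤X′ , u′ , u′∈X′ , u′∉K′ , X′≤K′+u′) , rK′<rX′) =
      lifted (lift K (K-sub , K⋖X , rK<rX))
      where
      K = K′ +S ⟨ v ⟩
      K-sub = +S-subspace K′-sub (⟨⟩-subspace v)
      K+u′-sub = +S-subspace K-sub (⟨⟩-subspace u′)
      u′∈B = ∩-≤ˡ B X u′ u′∈X′
      u′∈X = ∩-≤ʳ B X u′ u′∈X′
      u′∉K : u′ ∉ K
      u′∉K with ∈-or-∉ K u′
      ... | inj₂ u′∉K = u′∉K
      ... | inj₁ u′∈K = ⊥-elim (∈∧∉⇒⊥ {B} (+S-lub B-sub (≤-trans K′≤X′ (∩-≤ˡ B X)) (⟨⟩-least B B-sub u′∈B) v
                                          (exchange K′ K′-sub u′∈K u′∉K′)) v∉B)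
      X≤K+u′ : X ≤ (K +S ⟨ u′ ⟩)
      X≤K+u′ = ≤-trans (⋖-any-apex (∩-subspace B-sub X-sub) (⋖-∩ B-sub X-sub B⋖A X≤A v∈X v∉B) v∈X (cong (_∧ X v) v∉B))
        (+S-lub K+u′-sub (≤-trans X′≤K′+u′ (+S-mono (≤-+Sˡ {K′} (⟨⟩-subspace v)) ≤-refl))
                         (⟨⟩-least _ K+u′-sub (≤-+Sˡ {K} (⟨⟩-subspace u′) v (≤-+Sʳ {K′} K′-sub v (v∈⟨v⟩ v)))))
      K⋖X : K ⋖ X
      K⋖X = +S-lub X-sub (≤-trans K′≤X′ (∩-≤ʳ B X)) (⟨⟩-least X X-sub v∈X) , u′ , u′∈X , u′∉K , X≤K+u′
      rK<rX : r K ℤ.< r X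
      rK<rX = ℤ.≤-<-trans (ℤ.≤-trans (rank-+⟨⟩ K′-sub v) (ℤ.i<j⇒suc[i]≤j rK′<rX′))
                          (rank-drop-∩ A-sub B-sub X-sub B⋖A rB<rA X≤A v∈X v∉B)
      lifted : ∃[ B′ ] (RankDroppingHyperplane B′ A × K ≤ B′ × ∃[ u ] (u ∈ X × u ∉ B′)) →
               ∃[ B′ ] (RankDroppingHyperplane B′ A × K′ ≤ B′ × ∃[ u ] (u ∈ (B ∩ X) × u ∉ B′))
      lifted (B′ , B′-rdh@(B′-sub , _) , K≤B′ , u , u∈X , u∉B′) =
        B′ , B′-rdh , ≤-trans (≤-+Sˡ {K′} (⟨⟩-subspace v)) K≤B′ , u′ , u′∈X′ , u′∉B′
        where
        u′∉B′ : u′ ∉ B′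
        u′∉B′ with ∈-or-∉ B′ u′
        ... | inj₂ u′∉B′ = u′∉B′
        ... | inj₁ u′∈B′ = ⊥-elim (∈∧∉⇒⊥ {B′} (+S-lub B′-sub K≤B′ (⟨⟩-least B′ B′-sub u′∈B′) u (X≤K+u′ u u∈X)) u∉B′)

    -- Cut X down by rank-dropping hyperplanes of A until it is cyc(A), keeping it liftable;
    -- there a lift of K would have to miss a vector of cyc(A).
    no-rank-dropping-⋖-cyc : ∀ {X} → IsSubspace X → cyc ≤ X → X ≤ A → Liftable X → Acc ℕ._<_ ∣ X ∣ →
                              ∀ {K} → IsSubspace K → K ⋖ cyc → ¬ (r K ℤ.< r cyc)
    no-rank-dropping-⋖-cyc {X} X-sub cyc≤X X≤A lift (acc smaller) {K} K-sub K⋖cyc rK<rcyc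
      with ≤-or-escape X cyc
    ... | inj₁ X≤cyc = reached X≤cyc (lift K (K-sub , K⋖X , rK<rX))
      where
      K⋖X : K ⋖ X
      K⋖X = let K≤cyc , k , k∈cyc , k∉K , cyc≤K+k = K⋖cyc in
        ≤-trans K≤cyc cyc≤X , k , cyc≤X k k∈cyc , k∉K , ≤-trans X≤cyc cyc≤K+k
      rK<rX : r K ℤ.< r X
      rK<rX = subst (r K ℤ.<_) (rank-cong cyc-subspace X-sub cyc≤X X≤cyc) rK<rcyc
      reached : X ≤ cyc → ¬ (∃[ B ] (RankDroppingHyperplane B A × K ≤ B × ∃[ u ] (u ∈ X × u ∉ B)))
      reached X≤cyc (B , B-rdh , _ , u , u∈X , u∉B) =
        ∈∧∉⇒⊥ {B} (cyc-≤-rankDropping B-rdh u (X≤cyc u u∈X)) u∉B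
    ... | inj₂ (v , v∈X , v∉cyc) = descend (∉-cyc (X≤A v v∈X) v∉cyc)
      where
      descend : ¬ (∃[ B ] (RankDroppingHyperplane B A × v ∉ B))
      descend (B , B-rdh@(B-sub , _) , v∉B) =
        no-rank-dropping-⋖-cyc (∩-subspace B-sub X-sub) (∩-glb (cyc-≤-rankDropping B-rdh) cyc≤X)
          (≤-trans (∩-≤ʳ B X) X≤A) (liftable-∩ X-sub X≤A B-rdh v∈X v∉B lift)
          (smaller (∣∣-mono-< (∩-≤ʳ B X) v∈X (cong (_∧ X v) v∉B))) K-sub K⋖cyc rK<rcyc

    cyc-cyclic : IsCyclic r cyc
    cyc-cyclic = cyclic-intro cyc-subspace λ K K-sub K⋖cyc →
      ℤ.≮⇒≥ (no-rank-dropping-⋖-cyc A-sub cyc-≤ ≤-refl liftable-A (<-wellFounded _) K-sub K⋖cyc)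

proposition2p23 : (q : ℕ) → IsPrimePower q → (𝔽 : FiniteField q) → (n : ℕ)
    → (r : Setting.Sub 𝔽 n → ℤ) → Setting.IsQMatroid 𝔽 n r
    → (F₁ F₂ : Setting.Sub 𝔽 n)
    → Setting.IsCyclicFlat 𝔽 n r F₁ → Setting.IsCyclicFlat 𝔽 n r F₂
    → (Σ[ M ∈ Setting.Sub 𝔽 n ]
         (Setting.IsCyc 𝔽 n r (Setting._∩_ 𝔽 n F₁ F₂) M
           × Setting.IsMeetZ 𝔽 n r F₁ F₂ M))
    × (Σ[ J ∈ Setting.Sub 𝔽 n ]
         (Setting.IsCl 𝔽 n r (Setting._+S_ 𝔽 n F₁ F₂) J
           × Setting.IsJoinZ 𝔽 n r F₁ F₂ J))
proposition2p23 q _ 𝔽 n r QM F₁ F₂ (F₁-flat , F₁-cyclic) (F₂-flat , F₂-cyclic) =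
  (cyc , cyc-IsCyc , meet) , (cl , cl-IsCl , join)
  where
  open Setting 𝔽 n
  open Subspaces 𝔽 n
  open RankTheory 𝔽 n r QM
  F₁-sub = proj₁ F₁-flat
  F₂-sub = proj₁ F₂-flat
  open CyclicCore (∩-subspace F₁-sub F₂-sub)
  open Closure (+S-subspace F₁-sub F₂-sub)

  meet : IsMeetZ r F₁ F₂ cyc
  meet = (cyc-flat (∩-flat F₁-flat F₂-flat) , cyc-cyclic) ,
         ≤-trans cyc-≤ (∩-≤ˡ F₁ F₂) , ≤-trans cyc-≤ (∩-≤ʳ F₁ F₂) ,
         λ G (_ , G-cyclic) G≤F₁ G≤F₂ → cyclic-≤-cyc G-cyclic (∩-glb G≤F₁ G≤F₂)

  join : IsJoinZ r F₁ F₂ cl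
  join = (cl-flat , cl-cyclic (+S-cyclic F₁-cyclic F₂-cyclic)) ,
         ≤-trans (≤-+Sˡ {F₁} F₂-sub) S≤cl , ≤-trans (≤-+Sʳ {F₁} F₁-sub) S≤cl ,
         λ G (G-flat , _) F₁≤G F₂≤G → cl-least G-flat (+S-lub (proj₁ G-flat) F₁≤G F₂≤G)
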